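{- Let $\Gamma=\langle L,R,E\rangle$ be a countable bipartite graph. Then $\Gamma$ is $\aleph_0$-categorical if and only if each connected component of $\Gamma$ is $\aleph_0$-categorical and the set of connected components of $\Gamma$ is finite up to isomorphism.
   Context: A countable structure is $\aleph_0$-categorical iff its automorphism group has finitely many orbits on $n$-tuples for each $n\ge1$. A bipartite graph $\langle L,R,E\rangle$ has disjoint non-empty vertex sets $L$ (left) and $R$ (right) and edges $E\subseteq\{\{x,y\}:x\in L,y\in R\}$; it is regarded as a structure in the signature with unary relations for $L$ and $R$ and a binary edge relation, so isomorphisms must map left set to left set and right set to right set and preserve edges and non-edges. Connected components are the classes of the equivalence "$x=y$ or there is a path from $x$ to $y$", each considered with the induced bipartite graph structure. -}

module Defs where

open import Data.Bool using (Bool; true; false)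
open import Data.Nat using (ℕ)
open import Data.Fin using (Fin)
open import Data.Product using (Σ; ∃; _×_; _,_; proj₁)
open import Data.Irrelevant using (Irrelevant)
open import Function.Bundles using (_⤖_; _↣_; Bijection)
open import Relation.Binary.PropositionalEquality using (_≡_; _≢_)
open import Relation.Binary.Construct.Closure.ReflexiveTransitive using (Star)

-- A bipartite graph structure on a carrier V.
-- side v ≡ true  means v ∈ L (left);  side v ≡ false means v ∈ R (right).
-- edge x y ≡ true means {x,y} ∈ E.  Edges are symmetric and only join
-- a left vertex to a right vertex.  (Non-emptiness of L and R is imposed
-- separately, see BipartiteGraph, because connected components, e.g. an
-- isolated vertex, may have one side empty.)
record BipStructure : Set₁ where
  field
    V      : Set
    side   : V → Bool
    edge   : V → V → Bool
    edge-sym   : ∀ x y → edge x y ≡ edge y x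
    edge-cross : ∀ x y → edge x y ≡ true → side x ≢ side y

open BipStructure public

record BipartiteGraph : Set₁ where
  field
    str    : BipStructure
    L-nonempty : Σ (V str) λ v → side str v ≡ true
    R-nonempty : Σ (V str) λ v → side str v ≡ false

open BipartiteGraph public

Countable : BipStructure → Set
Countable Γ = V Γ ↣ ℕ

record _≅_ (Γ Δ : BipStructure) : Set where
  field
    bij       : V Γ ⤖ V Δ
    pres-side : ∀ x → side Δ (Bijection.to bij x) ≡ side Γ x
    pres-edge : ∀ x y → edge Δ (Bijection.to bij x) (Bijection.to bij y) ≡ edge Γ x y

Aut : BipStructure → Set
Aut Γ = Γ ≅ Γ

app : {Γ : BipStructure} → Aut Γ → V Γ → V Γ
app f = Bijection.to (_≅_.bij f)

Tuple : BipStructure → ℕ → Set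
Tuple Γ n = Fin n → V Γ

FinitelyManyOrbits : (Γ : BipStructure) → ℕ → Set
FinitelyManyOrbits Γ n =
  ∃ λ (k : ℕ) → ∃ λ (reps : Fin k → Tuple Γ n) →
    ∀ (t : Tuple Γ n) → ∃ λ (i : Fin k) → ∃ λ (f : Aut Γ) →
      ∀ j → app f (reps i j) ≡ t j

-- ℵ₀-categoricity (for countable structures), via Ryll-Nardzewski as in the
-- paper: finitely many automorphism orbits on n-tuples for every n ≥ 1.
Aleph0Categorical : BipStructure → Set
Aleph0Categorical Γ = ∀ (n : ℕ) → 1 Data.Nat.≤ n → FinitelyManyOrbits Γ n

-- Adjacency and connectivity (reflexive-transitive closure; since edges are
-- symmetric this is the equivalence "x = y or there is a path from x to y").
Adj : (Γ : BipStructure) → V Γ → V Γ → Set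
Adj Γ x y = edge Γ x y ≡ true

Connected : (Γ : BipStructure) → V Γ → V Γ → Set
Connected Γ = Star (Adj Γ)

-- The connected component of v with the induced bipartite structure.
-- The path witness is irrelevant so that each vertex occurs exactly once.
Component : (Γ : BipStructure) → V Γ → BipStructure
Component Γ v = record
  { V          = Σ (V Γ) λ x → Irrelevant (Connected Γ v x)
  ; side       = λ x → side Γ (proj₁ x)
  ; edge       = λ x y → edge Γ (proj₁ x) (proj₁ y)
  ; edge-sym   = λ x y → edge-sym Γ (proj₁ x) (proj₁ y)
  ; edge-cross = λ x y → edge-cross Γ (proj₁ x) (proj₁ y)
  }

FinitelyManyComponentTypes : BipStructure → Set
FinitelyManyComponentTypes Γ =
  ∃ λ (k : ℕ) → ∃ λ (reps : Fin k → V Γ) →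
    ∀ (v : V Γ) → ∃ λ (i : Fin k) → Component Γ v ≅ Component Γ (reps i)

module Submission where

-- Proposition 5.4: a countable bipartite graph Γ is ℵ₀-categorical iff every
-- connected component is ℵ₀-categorical and there are finitely many
-- components up to isomorphism.  ℵ₀-categoricity is given by the
-- Ryll-Nardzewski criterion (finitely many Aut-orbits on n-tuples), so the
-- argument is about orbits and countability plays no further role.
--
-- (⇒) An automorphism moving a tuple of a component C into C restricts to C,
-- and one moving u to v maps the component of u onto that of v; pulling back
-- the orbit relation of Γ along these inclusions gives both conditions.
-- (⇐) Call two n-tuples similar if the same pairs of coordinates share a
-- component and, for every m, their traces on the components of the m-th
-- coordinates are matched by an isomorphism.  Similarity has finite index,
-- being implied by equality of finitely many discrete invariants, and similar
-- tuples lie in one orbit: the automorphism is built one coordinate at a time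
-- by the extension step.

open import Defs
open import Level using (0ℓ)
open import Axiom.ExcludedMiddle using (ExcludedMiddle)
open import Data.Bool using (Bool; true; false)
open import Data.Empty using (⊥-elim)
open import Data.Fin using (Fin; zero; suc; toℕ; fromℕ<; combine; remQuot; splitAt; _↑ˡ_; _↑ʳ_)
open import Data.Fin.Properties using (remQuot-combine; splitAt-↑ˡ; splitAt-↑ʳ; toℕ-injective; toℕ-fromℕ<; toℕ<n)
open import Data.Irrelevant using ([_])
open import Data.Nat using (ℕ; zero; suc; _+_; _*_; s≤s; z≤n) renaming (_<_ to _<ℕ_; _≤_ to _≤ℕ_)
open import Data.Nat.Properties using (m<1+n⇒m<n∨m≡n; <⇒≤; ≤-refl)
open import Data.Product using (Σ; ∃; _×_; _,_; proj₁; proj₂)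
open import Data.Sum using (_⊎_; inj₁; inj₂)
open import Function.Bundles using (_⇔_; mk⇔; Bijection; mk⤖)
open import Relation.Binary.Core using (Rel; _⇒_)
open import Relation.Binary.PropositionalEquality using (_≡_; refl; sym; trans; cong; cong₂; subst; subst₂; module ≡-Reasoning)
open import Relation.Binary.Construct.Closure.ReflexiveTransitive using (ε; _◅_; _◅◅_; gmap; reverse)
open import Relation.Nullary using (Dec; yes; no; ¬_; does; recompute)

-- Isomorphisms with an explicit inverse; interchangeable with _≅_ but
-- easier to compose and invert.
record Iso (A B : BipStructure) : Set where
  field
    to      : V A → V B
    from    : V B → V A
    to-from : ∀ y → to (from y) ≡ y
    from-to : ∀ x → from (to x) ≡ x
    side-to : ∀ x → side B (to x) ≡ side A x
    edge-to : ∀ x y → edge B (to x) (to y) ≡ edge A x y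
open Iso public

Iso⇒≅ : ∀ {A B} → Iso A B → A ≅ B
Iso⇒≅ f = record
  { bij       = mk⤖ {to = to f} (injective , surjective)
  ; pres-side = side-to f
  ; pres-edge = edge-to f
  }
  where
  injective : ∀ {x y} → to f x ≡ to f y → x ≡ y
  injective {x} {y} e = trans (sym (from-to f x)) (trans (cong (from f) e) (from-to f y))
  surjective : ∀ y → ∃ λ x → ∀ {z} → z ≡ x → to f z ≡ y
  surjective y = from f y , λ { refl → to-from f y }

≅⇒Iso : ∀ {A B} → A ≅ B → Iso A B
≅⇒Iso {A} {B} f = record
  { to = Bijection.to bij ; from = preimage ; to-from = to-preimage ; from-to = preimage-to
  ; side-to = _≅_.pres-side f ; edge-to = _≅_.pres-edge f }
  where
  bij = _≅_.bij f
  preimage : V B → V A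
  preimage y = proj₁ (Bijection.surjective bij y)
  to-preimage : ∀ y → Bijection.to bij (preimage y) ≡ y
  to-preimage y = proj₂ (Bijection.surjective bij y) refl
  preimage-to : ∀ x → preimage (Bijection.to bij x) ≡ x
  preimage-to x = Bijection.injective bij (to-preimage (Bijection.to bij x))

idIso : ∀ {A} → Iso A A
idIso = record { to = λ x → x ; from = λ x → x ; to-from = λ _ → refl ; from-to = λ _ → refl
               ; side-to = λ _ → refl ; edge-to = λ _ _ → refl }

invIso : ∀ {A B} → Iso A B → Iso B A
invIso {A} {B} f = record
  { to = from f ; from = to f ; to-from = from-to f ; from-to = to-from f
  ; side-to = λ y → trans (sym (side-to f (from f y))) (cong (side B) (to-from f y))
  ; edge-to = λ x y → trans (sym (edge-to f (from f x) (from f y)))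
                            (cong₂ (edge B) (to-from f x) (to-from f y))
  }

_∘ᵢ_ : ∀ {A B C} → Iso B C → Iso A B → Iso A C
g ∘ᵢ f = record
  { to = λ x → to g (to f x) ; from = λ z → from f (from g z)
  ; to-from = λ z → trans (cong (to g) (to-from f (from g z))) (to-from g z)
  ; from-to = λ x → trans (cong (from f) (from-to g (to f x))) (from-to f x)
  ; side-to = λ x → trans (side-to g (to f x)) (side-to f x)
  ; edge-to = λ x y → trans (edge-to g (to f x) (to f y)) (edge-to f x y) }

conn-sym : ∀ {G x y} → Connected G x y → Connected G y x
conn-sym {G} = reverse (λ {x} {y} e → trans (edge-sym G y x) e)

conn-map : ∀ {A B} (f : Iso A B) {x y} → Connected A x y → Connected B (to f x) (to f y)
conn-map f = gmap (to f) (λ {x} {y} e → trans (edge-to f x y) e)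

conn-reflect : ∀ {A B} (f : Iso A B) {x y} → Connected B (to f x) (to f y) → Connected A x y
conn-reflect {A} f {x} {y} c = subst₂ (Connected A) (from-to f x) (from-to f y) (conn-map (invIso f) c)

≡⇒conn : ∀ {G x y} → x ≡ y → Connected G x y
≡⇒conn refl = ε

no-edge-across : ∀ {G c u v} → Connected G c u → ¬ Connected G c v → edge G u v ≡ false
no-edge-across {G} {c} {u} {v} cu ¬cv with edge G u v in uv
... | true  = ⊥-elim (¬cv (cu ◅◅ (uv ◅ ε)))
... | false = refl

both-apart : ∀ {G c u v c' u' v'} → Connected G c u → ¬ Connected G c v →
             Connected G c' u' → ¬ Connected G c' v' → edge G u' v' ≡ edge G u v
both-apart {G} cu ¬cv cu' ¬cv' = trans (no-edge-across {G} cu' ¬cv') (sym (no-edge-across {G} cu ¬cv))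

-- Components.  Membership proofs are irrelevant, so elements are determined by
-- the underlying vertex; with excluded middle the path can be recovered.

member-path : ExcludedMiddle 0ℓ → ∀ {G v} (z : V (Component G v)) → Connected G v (proj₁ z)
member-path em (x , [ p ]) = recompute em p

member-≡ : ∀ {G v} {x y : V G} .{p : Connected G v x} .{q : Connected G v y} → x ≡ y →
           _≡_ {A = V (Component G v)} (x , [ p ]) (y , [ q ])
member-≡ refl = refl

restrict : ∀ {A B} (h : Iso A B) (x : V A) → Iso (Component A x) (Component B (to h x))
restrict {A} {B} h x = record
  { to      = λ { (z , [ q ]) → to h z , [ conn-map h q ] }
  ; from    = λ { (w , [ q ]) → from h w , [ subst (λ u → Connected A u (from h w)) (from-to h x)
                                                    (conn-map (invIso h) q) ] }
  ; to-from = λ { (w , [ q ]) → member-≡ {B} (to-from h w) }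
  ; from-to = λ { (z , [ q ]) → member-≡ {A} (from-to h z) }
  ; side-to = λ { (z , [ q ]) → side-to h z }
  ; edge-to = λ { (z , [ q ]) (z' , [ q' ]) → edge-to h z z' } }

reroot : ∀ {G x y} → Connected G x y → Iso (Component G x) (Component G y)
reroot {G} p = record
  { to      = λ { (z , [ q ]) → z , [ conn-sym {G} p ◅◅ q ] }
  ; from    = λ { (z , [ q ]) → z , [ p ◅◅ q ] }
  ; to-from = λ _ → refl
  ; from-to = λ _ → refl
  ; side-to = λ _ → refl
  ; edge-to = λ _ _ → refl }

-- Given an isomorphism χ between the components of a and b, the map acting as
-- χ on the component of a, as χ⁻¹ on the rest of the component of b, and as
-- the identity elsewhere.
module Swap (em : ExcludedMiddle 0ℓ) (G : BipStructure) (a b : V G)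
            (χ : Iso (Component G a) (Component G b)) where
  private
    C = Connected G

  data Region (y : V G) : Set where
    in-a    : C a y → Region y
    in-b    : ¬ C a y → C b y → Region y
    outside : ¬ C a y → ¬ C b y → Region y

  region : ∀ y → Region y
  region y with em {C a y} | em {C b y}
  ... | yes p | _     = in-a p
  ... | no ¬p | yes q = in-b ¬p q
  ... | no ¬p | no ¬q = outside ¬p ¬q

  move : ∀ y → Region y → V G
  move y (in-a p)      = proj₁ (to χ (y , [ p ]))
  move y (in-b _ q)    = proj₁ (from χ (y , [ q ]))
  move y (outside _ _) = y

  swap : V G → V G
  swap y = move y (region y)

  swap-a : ∀ y (p : C a y) → swap y ≡ proj₁ (to χ (y , [ p ]))
  swap-a y p = go (region y)
    where
    go : (r : Region y) → move y r ≡ proj₁ (to χ (y , [ p ]))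
    go (in-a _)       = refl
    go (in-b ¬p _)    = ⊥-elim (¬p p)
    go (outside ¬p _) = ⊥-elim (¬p p)

  swap-b : ∀ y → ¬ C a y → (q : C b y) → swap y ≡ proj₁ (from χ (y , [ q ]))
  swap-b y ¬p q = go (region y)
    where
    go : (r : Region y) → move y r ≡ proj₁ (from χ (y , [ q ]))
    go (in-a p)       = ⊥-elim (¬p p)
    go (in-b _ _)     = refl
    go (outside _ ¬q) = ⊥-elim (¬q q)

  swap-outside : ∀ y → ¬ C a y → ¬ C b y → swap y ≡ y
  swap-outside y ¬p ¬q = go (region y)
    where
    go : (r : Region y) → move y r ≡ y
    go (in-a p)      = ⊥-elim (¬p p)
    go (in-b _ q)    = ⊥-elim (¬q q)
    go (outside _ _) = refl

  image-of-a : ∀ y (p : C a y) → C b (move y (in-a p))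
  image-of-a y p = member-path em {G} (to χ (y , [ p ]))

  image-of-b : ∀ y (¬p : ¬ C a y) (q : C b y) →
               C a (move y (in-b ¬p q)) × ¬ C b (move y (in-b ¬p q))
  image-of-b y ¬p q = a∼ , λ b∼ → ¬p (a∼ ◅◅ conn-sym {G} b∼ ◅◅ q)
    where
    a∼ = member-path em {G} (from χ (y , [ q ]))

  move-side : ∀ y (r : Region y) → side G (move y r) ≡ side G y
  move-side y (in-a p)      = side-to χ (y , [ p ])
  move-side y (in-b _ q)    = side-to (invIso χ) (y , [ q ])
  move-side y (outside _ _) = refl

  -- Edges inside one region are preserved by χ, χ⁻¹ or the identity; between
  -- different regions there are no edges before or after moving.
  move-edge : ∀ x y (r : Region x) (r' : Region y) → edge G (move x r) (move y r') ≡ edge G x y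
  move-edge x y (in-a p) (in-a p') = edge-to χ (x , [ p ]) (y , [ p' ])
  move-edge x y (in-b _ q) (in-b _ q') = edge-to (invIso χ) (x , [ q ]) (y , [ q' ])
  move-edge x y (outside _ _) (outside _ _) = refl
  move-edge x y (in-a p) (in-b ¬p' q') =
    both-apart {G} p ¬p' (image-of-a x p) (proj₂ (image-of-b y ¬p' q'))
  move-edge x y (in-a p) (outside ¬p' ¬q') = both-apart {G} p ¬p' (image-of-a x p) ¬q'
  move-edge x y (in-b ¬p q) (outside ¬p' ¬q') =
    both-apart {G} q ¬q' (proj₁ (image-of-b x ¬p q)) ¬p'
  move-edge x y r@(in-b _ _) r'@(in-a _) =
    trans (edge-sym G _ _) (trans (move-edge y x r' r) (edge-sym G y x))
  move-edge x y r@(outside _ _) r'@(in-a _) =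
    trans (edge-sym G _ _) (trans (move-edge y x r' r) (edge-sym G y x))
  move-edge x y r@(outside _ _) r'@(in-b _ _) =
    trans (edge-sym G _ _) (trans (move-edge y x r' r) (edge-sym G y x))

  swap-side : ∀ y → side G (swap y) ≡ side G y
  swap-side y = move-side y (region y)

  swap-edge : ∀ x y → edge G (swap x) (swap y) ≡ edge G x y
  swap-edge x y = move-edge x y (region x) (region y)

swap-inverse : (em : ExcludedMiddle 0ℓ) (G : BipStructure) (a b : V G)
               (χ : Iso (Component G a) (Component G b)) (χ' : Iso (Component G b) (Component G a)) →
               (∀ z → to χ' (to χ z) ≡ z) → (∀ z → from χ' (from χ z) ≡ z) →
               ∀ y → Swap.swap em G b a χ' (Swap.swap em G a b χ y) ≡ y
swap-inverse em G a b χ χ' to-inv from-inv y = go (S.region y)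
  where
  module S = Swap em G a b χ
  module T = Swap em G b a χ'
  go : (r : S.Region y) → T.swap (S.move y r) ≡ y
  go (S.in-a p) =
    trans (T.swap-a _ (S.image-of-a y p)) (cong proj₁ (to-inv (y , [ p ])))
  go (S.in-b ¬p q) =
    trans (T.swap-b _ (proj₂ (S.image-of-b y ¬p q)) (proj₁ (S.image-of-b y ¬p q)))
          (cong proj₁ (from-inv (y , [ q ])))
  go (S.outside ¬p ¬q) = T.swap-outside y ¬q ¬p

swapIso : (em : ExcludedMiddle 0ℓ) (G : BipStructure) {a b : V G} →
          Iso (Component G a) (Component G b) → Iso G G
swapIso em G {a} {b} χ = record
  { to = S.swap ; from = Swap.swap em G b a (invIso χ)
  ; to-from = swap-inverse em G b a (invIso χ) χ (to-from χ) (from-to χ)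
  ; from-to = swap-inverse em G a b χ (invIso χ) (from-to χ) (to-from χ)
  ; side-to = S.swap-side ; edge-to = S.swap-edge }
  where
  module S = Swap em G a b χ

extend : ExcludedMiddle 0ℓ → ∀ {G} (f : Iso G G) {x y : V G} →
         (ψ : Iso (Component G x) (Component G y)) →
         Σ (Iso G G) λ f' →
           (∀ z (p : Connected G x z) → to f' z ≡ proj₁ (to ψ (z , [ p ]))) ×
           (∀ w → ¬ Connected G (to f x) (to f w) → ¬ Connected G y (to f w) → to f' w ≡ to f w)
extend em {G} f {x} {y} ψ = swapIso em G χ ∘ᵢ f , on-component , elsewhere
  where
  χ : Iso (Component G (to f x)) (Component G y)
  χ = ψ ∘ᵢ (reroot (≡⇒conn {G} (from-to f x)) ∘ᵢ restrict (invIso f) (to f x))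
  open Swap em G (to f x) y χ using (swap; swap-a; swap-outside)
  on-component : ∀ z (p : Connected G x z) → swap (to f z) ≡ proj₁ (to ψ (z , [ p ]))
  on-component z p = trans (swap-a (to f z) (conn-map f p))
                           (cong (λ u → proj₁ (to ψ u)) (member-≡ {G} (from-to f z)))
  elsewhere : ∀ w → ¬ Connected G (to f x) (to f w) → ¬ Connected G y (to f w) → swap (to f w) ≡ to f w
  elsewhere w = swap-outside (to f w)

FiniteIndex : {T : Set} → Rel T 0ℓ → Set
FiniteIndex {T} R = ∃ λ (k : ℕ) → ∃ λ (reps : Fin k → T) → ∀ t → ∃ λ i → R (reps i) t

-- Euclidean relations (such as equivalences) allow a cover by one
-- representative to be transported to another related element.
Euclidean : {T : Set} → Rel T 0ℓ → Set
Euclidean R = ∀ {a b c} → R a b → R a c → R b c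

≡-euclidean : {T : Set} → Euclidean {T} _≡_
≡-euclidean p q = trans (sym p) q

∀-euclidean : ∀ {T n} {R : Fin n → Rel T 0ℓ} → (∀ m → Euclidean (R m)) →
              Euclidean (λ a b → ∀ m → R m a b)
∀-euclidean eucl p q m = eucl m (p m) (q m)

finiteIndex-mono : ∀ {T} {R R' : Rel T 0ℓ} → R ⇒ R' → FiniteIndex R → FiniteIndex R'
finiteIndex-mono R⇒R' (k , reps , cover) = k , reps , λ t → proj₁ (cover t) , R⇒R' (proj₂ (cover t))

finiteIndex-× : ∀ {S T} {R : Rel S 0ℓ} {R' : Rel T 0ℓ} → FiniteIndex R → FiniteIndex R' →
                FiniteIndex (λ (p q : S × T) → R (proj₁ p) (proj₁ q) × R' (proj₂ p) (proj₂ q))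
finiteIndex-× {S} {T} {R} {R'} (k , reps , cover) (k' , reps' , cover') = k * k' , rep , cover×
  where
  rep : Fin (k * k') → S × T
  rep c = reps (proj₁ (remQuot {k} k' c)) , reps' (proj₂ (remQuot {k} k' c))
  cover× : ∀ p → ∃ λ c → R (proj₁ (rep c)) (proj₁ p) × R' (proj₂ (rep c)) (proj₂ p)
  cover× (s , t) with cover s | cover' t
  ... | i , r | i' , r' =
    combine i i' , subst (λ ii → R (reps (proj₁ ii)) s × R' (reps' (proj₂ ii)) t)
                         (sym (remQuot-combine {k} {k'} i i')) (r , r')

Enumerable : Set → Set
Enumerable C = FiniteIndex {C} _≡_

enum-Bool : Enumerable Bool
enum-Bool = 2 , (λ { zero → true ; (suc _) → false }) , λ { true → zero , refl ; false → suc zero , refl }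

enum-Fin : ∀ k → Enumerable (Fin k)
enum-Fin k = k , (λ i → i) , λ i → i , refl

enum-Σ : ∀ k (B : Fin k → Set) → (∀ i → Enumerable (B i)) → Enumerable (Σ (Fin k) B)
enum-Σ zero B _ = 0 , (λ ()) , λ { (() , _) }
enum-Σ (suc k) B enum with enum zero | enum-Σ k (λ i → B (suc i)) (λ i → enum (suc i))
... | N , list , listed | N' , list' , listed' = N + N' , (λ c → list-Σ (splitAt N c)) , cover
  where
  list-Σ : Fin N ⊎ Fin N' → Σ (Fin (suc k)) B
  list-Σ (inj₁ j) = zero , list j
  list-Σ (inj₂ j) = suc (proj₁ (list' j)) , proj₂ (list' j)
  cover : ∀ c → ∃ λ j → list-Σ (splitAt N j) ≡ c
  cover (zero , x) with listed x
  ... | j , refl = j ↑ˡ N' , cong list-Σ (splitAt-↑ˡ N j N')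
  cover (suc i , x) with listed' (i , x)
  ... | j , eq = N ↑ʳ j , trans (cong list-Σ (splitAt-↑ʳ N N' j))
                                (cong (λ z → suc (proj₁ z) , proj₂ z) eq)

module Choice (em : ExcludedMiddle 0ℓ) where

  choose : ∀ {S : Set} {P : S → Set} → S → Dec (∃ P) → S
  choose _  (yes (s , _)) = s
  choose s₀ (no _)        = s₀

  choose-spec : ∀ {S : Set} {P : S → Set} (s₀ : S) (d : Dec (∃ P)) → ∃ P → P (choose s₀ d)
  choose-spec _ (yes (_ , p)) _ = p
  choose-spec _ (no ∄) w        = ⊥-elim (∄ w)

  -- Pulling back a Euclidean relation of finite index along any map to an
  -- inhabited set: pick for each representative an element of S mapped to an
  -- element it covers.
  pullback : ∀ {S T : Set} {R : Rel T 0ℓ} (ι : S → T) → S → Euclidean R → FiniteIndex R →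
             FiniteIndex (λ s s' → R (ι s) (ι s'))
  pullback {S} {T} {R} ι s₀ eucl (k , reps , cover) = k , rep , cover'
    where
    Covered : Fin k → S → Set
    Covered i s = R (reps i) (ι s)
    rep : Fin k → S
    rep i = choose s₀ (em {∃ (Covered i)})
    cover' : ∀ s → ∃ λ i → R (ι (rep i)) (ι s)
    cover' s with cover (ι s)
    ... | i , r = i , eucl (choose-spec s₀ (em {∃ (Covered i)}) (s , r)) r

  kernel : ∀ {T C : Set} → T → Enumerable C → (f : T → C) → FiniteIndex (λ a b → f a ≡ f b)
  kernel t₀ enum f = pullback f t₀ ≡-euclidean enum

  intersection : ∀ {T} {R R' : Rel T 0ℓ} → T → Euclidean R → Euclidean R' →
                 FiniteIndex R → FiniteIndex R' → FiniteIndex (λ a b → R a b × R' a b)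
  intersection {T} {R} {R'} t₀ eucl eucl' fi fi' =
    pullback {R = λ p q → R (proj₁ p) (proj₁ q) × R' (proj₂ p) (proj₂ q)} (λ t → t , t) t₀ (λ (p , p') (q , q') → eucl p q , eucl' p' q') (finiteIndex-× {R = R} {R'} fi fi')

  intersection-all : ∀ {T} → T → ∀ n (R : Fin n → Rel T 0ℓ) → (∀ m → Euclidean (R m)) →
                     (∀ m → FiniteIndex (R m)) → FiniteIndex (λ a b → ∀ m → R m a b)
  intersection-all t₀ zero R _ _ = 1 , (λ _ → t₀) , λ t → zero , λ ()
  intersection-all t₀ (suc n) R eucl fi =
    finiteIndex-mono {R = λ a b → R zero a b × (∀ m → R (suc m) a b)} split
      (intersection {R = R zero} {R' = λ a b → ∀ m → R (suc m) a b}
        t₀ (eucl zero) (∀-euclidean {R = λ m → R (suc m)} (λ m → eucl (suc m))) (fi zero)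
        (intersection-all t₀ n (λ m → R (suc m)) (λ m → eucl (suc m)) (λ m → fi (suc m))))
    where
    split : ∀ {a b} → R zero a b × (∀ m → R (suc m) a b) → ∀ m → R m a b
    split (r , _) zero    = r
    split (_ , r) (suc m) = r m

Matches : (X Y : BipStructure) {n : ℕ} → Tuple X n → Tuple Y n → Set
Matches X Y s t = Σ (Iso X Y) λ ψ → ∀ j → to ψ (s j) ≡ t j

matches-along : ∀ {X Y n} (φ : Iso X Y) {s : Tuple X n} → Matches X Y s (λ j → to φ (s j))
matches-along φ = φ , λ _ → refl

matches-trans : ∀ {X Y Z n} {s : Tuple X n} {t : Tuple Y n} {u : Tuple Z n} →
                Matches X Y s t → Matches Y Z t u → Matches X Z s u
matches-trans (ψ , ψs≡t) (χ , χt≡u) = χ ∘ᵢ ψ , λ j → trans (cong (to χ) (ψs≡t j)) (χt≡u j)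

matches-sym : ∀ {X Y n} {s : Tuple X n} {t : Tuple Y n} → Matches X Y s t → Matches Y X t s
matches-sym {s = s} (ψ , ψs≡t) = invIso ψ , λ j → trans (cong (from ψ) (sym (ψs≡t j))) (from-to ψ (s j))

matches-euclid : ∀ {X Y Z n} {s : Tuple X n} {t : Tuple Y n} {u : Tuple Z n} →
                 Matches X Y s t → Matches X Z s u → Matches Y Z t u
matches-euclid m m' = matches-trans (matches-sym m) m'

SameOrbit : (Γ : BipStructure) (n : ℕ) → Rel (Tuple Γ n) 0ℓ
SameOrbit Γ n = Matches Γ Γ

AutOrbit : (Γ : BipStructure) (n : ℕ) → Rel (Tuple Γ n) 0ℓ
AutOrbit Γ n s t = ∃ λ (f : Aut Γ) → ∀ j → app f (s j) ≡ t j

orbits⇒finiteIndex : ∀ {Γ n} → FinitelyManyOrbits Γ n → FiniteIndex (SameOrbit Γ n)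
orbits⇒finiteIndex {Γ} {n} = finiteIndex-mono {R = AutOrbit Γ n} {R' = SameOrbit Γ n} λ (f , fs≡t) → ≅⇒Iso f , fs≡t

finiteIndex⇒orbits : ∀ {Γ n} → FiniteIndex (SameOrbit Γ n) → FinitelyManyOrbits Γ n
finiteIndex⇒orbits {Γ} {n} = finiteIndex-mono {R = SameOrbit Γ n} {R' = AutOrbit Γ n} λ (ψ , ψs≡t) → Iso⇒≅ ψ , ψs≡t

-- An automorphism relating two tuples of positive length inside the component
-- of v maps that component onto itself, so it restricts to the component.
component-orbit : ExcludedMiddle 0ℓ → ∀ {G v n} {s t : Tuple (Component G v) (suc n)} →
                  SameOrbit G (suc n) (λ j → proj₁ (s j)) (λ j → proj₁ (t j)) →
                  SameOrbit (Component G v) (suc n) s t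
component-orbit em {G} {v} {s = s} {t} (h , hs≡t) =
  reroot back ∘ᵢ restrict h v , λ j → member-≡ {G} (hs≡t j)
  where
  back : Connected G (to h v) v
  back = conn-map h (member-path em {G} (s zero)) ◅◅ ≡⇒conn {G} (hs≡t zero)
           ◅◅ conn-sym {G} (member-path em {G} (t zero))

-- Forward direction, first half: orbits of a component are traces of orbits of G.
components-categorical : ExcludedMiddle 0ℓ → (G : BipStructure) → Aleph0Categorical G →
                         ∀ v → Aleph0Categorical (Component G v)
components-categorical em G cat v (suc n) (s≤s z≤n) =
  finiteIndex⇒orbits
    (finiteIndex-mono (λ {s} {t} → component-orbit em {s = s} {t})
      (pullback (λ s j → proj₁ (s j)) (λ _ → v , [ ε ]) (matches-euclid {G})
        (orbits⇒finiteIndex (cat (suc n) (s≤s z≤n)))))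
  where open Choice em

orbit⇒iso-components : ∀ {G u v} → SameOrbit G 1 (λ _ → u) (λ _ → v) → Component G v ≅ Component G u
orbit⇒iso-components {G} {u} (h , hu≡v) =
  Iso⇒≅ (invIso (reroot (≡⇒conn {G} (hu≡v zero)) ∘ᵢ restrict h u))

-- Forward direction, second half: the orbits on single vertices list the component types.
finitely-many-component-types : ExcludedMiddle 0ℓ → (Γ : BipartiteGraph) → Aleph0Categorical (str Γ) →
                                FinitelyManyComponentTypes (str Γ)
finitely-many-component-types em Γ cat =
  finiteIndex-mono {R' = λ u v → Component (str Γ) v ≅ Component (str Γ) u} orbit⇒iso-components
    (pullback (λ v _ → v) (proj₁ (L-nonempty Γ)) (matches-euclid {str Γ})
      (orbits⇒finiteIndex (cat 1 (s≤s z≤n))))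
  where open Choice em

module Backward (em : ExcludedMiddle 0ℓ) (G : BipStructure) (n : ℕ) where
  private
    C = Connected G

  linked : Tuple G n → Fin n → Fin n → Bool
  linked t i m = does (em {C (t i) (t m)})

  -- y as an element of the component of x, or x itself if y lies elsewhere
  localize : ∀ x y → Dec (C x y) → V (Component G x)
  localize x y (yes p) = y , [ p ]
  localize x y (no _)  = x , [ ε ]

  localize-inside : ∀ x y (p : C x y) d → localize x y d ≡ (y , [ p ])
  localize-inside x y p (yes _) = refl
  localize-inside x y p (no ¬p) = ⊥-elim (¬p p)

  trace : (t : Tuple G n) (m : Fin n) → Tuple (Component G (t m)) n
  trace t m j = localize (t m) (t j) em

  SameLinks : Fin n → Rel (Tuple G n) 0ℓ
  SameLinks i a b = ∀ m → linked a i m ≡ linked b i m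

  SameTrace : Fin n → Rel (Tuple G n) 0ℓ
  SameTrace m a b = Matches (Component G (a m)) (Component G (b m)) (trace a m) (trace b m)

  sameLinks-euclidean : ∀ i → Euclidean (SameLinks i)
  sameLinks-euclidean i = ∀-euclidean {R = λ m a b → linked a i m ≡ linked b i m} λ _ → ≡-euclidean

  sameTrace-euclidean : ∀ m → Euclidean (SameTrace m)
  sameTrace-euclidean m = matches-euclid

  Similar : Rel (Tuple G n) 0ℓ
  Similar a b = (∀ i → SameLinks i a b) × (∀ m → SameTrace m a b)

  does-transfer : ∀ {P Q : Set} (p? : Dec P) (q? : Dec Q) → does p? ≡ does q? → P → Q
  does-transfer (yes _) (yes q) _  _ = q
  does-transfer (no ¬p) _       _  p = ⊥-elim (¬p p)
  does-transfer (yes _) (no _)  () _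

  -- Similar tuples lie in one orbit: the automorphism is corrected one
  -- coordinate at a time by the extension step.
  module Reconstruct {a b : Tuple G n} (similar : Similar a b) where
    linked⇒ : ∀ i m → C (a i) (a m) → C (b i) (b m)
    linked⇒ i m = does-transfer em em (proj₁ similar i m)

    linked⇐ : ∀ i m → C (b i) (b m) → C (a i) (a m)
    linked⇐ i m = does-transfer em em (sym (proj₁ similar i m))

    ψ : ∀ m → Iso (Component G (a m)) (Component G (b m))
    ψ m = proj₁ (proj₂ similar m)

    ψ-coordinates : ∀ m j (p : C (a m) (a j)) → proj₁ (to (ψ m) (a j , [ p ])) ≡ b j
    ψ-coordinates m j p = begin
      proj₁ (to (ψ m) (a j , [ p ])) ≡⟨ cong (λ z → proj₁ (to (ψ m) z)) (sym (localize-inside _ _ p em)) ⟩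
      proj₁ (to (ψ m) (trace a m j)) ≡⟨ cong proj₁ (proj₂ (proj₂ similar m) j) ⟩
      proj₁ (trace b m j)            ≡⟨ cong proj₁ (localize-inside _ _ (linked⇒ m j p) em) ⟩
      b j                            ∎
      where open ≡-Reasoning

    CorrectUpTo : Iso G G → ℕ → Set
    CorrectUpTo f k = ∀ i j → toℕ i <ℕ k → C (a i) (a j) → to f (a j) ≡ b j

    step : ∀ k (x : Fin n) → toℕ x ≡ k → (f : Iso G G) → CorrectUpTo f k →
           Σ (Iso G G) λ f' → CorrectUpTo f' (suc k)
    step k x x≡k f correct = proj₁ extension , correct'
      where
      extension = extend em f (ψ x)
      correct' : CorrectUpTo (proj₁ extension) (suc k)
      correct' i j i≤k c with em {C (a x) (a j)}
      ... | yes p = trans (proj₁ (proj₂ extension) (a j) p) (ψ-coordinates x j p)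
      ... | no ¬p with m<1+n⇒m<n∨m≡n i≤k
      ...   | inj₂ i≡k = ⊥-elim (¬p (subst (λ y → C (a y) (a j)) (toℕ-injective (trans i≡k (sym x≡k))) c))
      ...   | inj₁ i<k = trans (proj₂ (proj₂ extension) (a j) apart-image apart-target) (correct i j i<k c)
        where
        apart-image : ¬ C (to f (a x)) (to f (a j))
        apart-image h = ¬p (conn-reflect f h)
        apart-target : ¬ C (b x) (to f (a j))
        apart-target h = ¬p (linked⇐ x j (subst (C (b x)) (correct i j i<k c) h))

    build : ∀ k → k ≤ℕ n → Σ (Iso G G) λ f → CorrectUpTo f k
    build zero    _   = idIso , λ _ _ ()
    build (suc k) k<n = step k (fromℕ< k<n) (toℕ-fromℕ< k<n) (proj₁ previous) (proj₂ previous)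
      where previous = build k (<⇒≤ k<n)

  similar⇒sameOrbit : Similar ⇒ SameOrbit G n
  similar⇒sameOrbit similar = proj₁ built , λ j → proj₂ built j j (toℕ<n j) ε
    where built = Reconstruct.build similar n ≤-refl

  -- When the components have finitely many types, each with finitely many
  -- orbits on n-tuples, similarity is implied by equality of finitely many
  -- discrete invariants and so has finite index.
  module Invariants (components-cat : ∀ v → Aleph0Categorical (Component G v))
                    (types : FinitelyManyComponentTypes G) (1≤n : 1 ≤ℕ n) (t₀ : Tuple G n) where
    open Choice em

    k : ℕ
    k = proj₁ types

    R : Fin k → BipStructure
    R i = Component G (proj₁ (proj₂ types) i)

    type-of : V G → Fin k
    type-of v = proj₁ (proj₂ (proj₂ types) v)

    type-iso : ∀ v → Iso (Component G v) (R (type-of v))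
    type-iso v = ≅⇒Iso (proj₂ (proj₂ (proj₂ types) v))

    orbits : ∀ i → FiniteIndex (SameOrbit (R i) n)
    orbits i = orbits⇒finiteIndex (components-cat _ n 1≤n)

    orbit-rep : ∀ i → Fin (proj₁ (orbits i)) → Tuple (R i) n
    orbit-rep i = proj₁ (proj₂ (orbits i))

    Code : Set
    Code = Σ (Fin k) λ i → Fin (proj₁ (orbits i))

    orbit-of : ∀ t m → ∃ λ o → SameOrbit (R (type-of (t m))) n (orbit-rep _ o)
                                          (λ j → to (type-iso (t m)) (trace t m j))
    orbit-of t m = proj₂ (proj₂ (orbits (type-of (t m)))) (λ j → to (type-iso (t m)) (trace t m j))

    code : Fin n → Tuple G n → Code
    code m t = type-of (t m) , proj₁ (orbit-of t m)

    matched-by-code : ∀ {i i' X X'} {o o'} (φ : Iso X (R i)) (φ' : Iso X' (R i'))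
                      {s : Tuple X n} {s' : Tuple X' n} → _≡_ {A = Code} (i , o) (i' , o') →
                      SameOrbit (R i) n (orbit-rep i o) (λ j → to φ (s j)) →
                      SameOrbit (R i') n (orbit-rep i' o') (λ j → to φ' (s' j)) → Matches X X' s s'
    matched-by-code φ φ' refl g g' =
      matches-trans (matches-along φ) (matches-trans (matches-euclid g g') (matches-sym (matches-along φ')))

    same-code⇒same-trace : ∀ m {a b} → code m a ≡ code m b → SameTrace m a b
    same-code⇒same-trace m {a} {b} eq =
      matched-by-code (type-iso (a m)) (type-iso (b m)) eq (proj₂ (orbit-of a m)) (proj₂ (orbit-of b m))

    sameLinks-finiteIndex : ∀ i → FiniteIndex (SameLinks i)
    sameLinks-finiteIndex i =
      intersection-all t₀ n _ (λ _ → ≡-euclidean) λ m → kernel t₀ enum-Bool (λ t → linked t i m)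

    sameTrace-finiteIndex : ∀ m → FiniteIndex (SameTrace m)
    sameTrace-finiteIndex m =
      finiteIndex-mono (λ {a} {b} → same-code⇒same-trace m {a} {b})
        (kernel t₀ (enum-Σ k _ λ i → enum-Fin _) (code m))

    similar-finiteIndex : FiniteIndex Similar
    similar-finiteIndex =
      intersection {R = λ a b → ∀ i → SameLinks i a b} {R' = λ a b → ∀ m → SameTrace m a b} t₀
        (∀-euclidean sameLinks-euclidean) (∀-euclidean sameTrace-euclidean)
        (intersection-all t₀ n SameLinks sameLinks-euclidean sameLinks-finiteIndex)
        (intersection-all t₀ n SameTrace sameTrace-euclidean sameTrace-finiteIndex)

aleph0-from-components : ExcludedMiddle 0ℓ → (Γ : BipartiteGraph) →
                         (∀ v → Aleph0Categorical (Component (str Γ) v)) →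
                         FinitelyManyComponentTypes (str Γ) → Aleph0Categorical (str Γ)
aleph0-from-components em Γ components-cat types n 1≤n =
  finiteIndex⇒orbits (finiteIndex-mono (λ {a} {b} → similar⇒sameOrbit {a} {b}) similar-finiteIndex)
  where
  open Backward em (str Γ) n
  open Invariants components-cat types 1≤n (λ _ → proj₁ (L-nonempty Γ))

proposition5p4 : ExcludedMiddle 0ℓ → (Γ : BipartiteGraph) → Countable (str Γ) →
    Aleph0Categorical (str Γ) ⇔
      ((∀ v → Aleph0Categorical (Component (str Γ) v)) × FinitelyManyComponentTypes (str Γ))
proposition5p4 em Γ _ = mk⇔
  (λ cat → components-categorical em (str Γ) cat , finitely-many-component-types em Γ cat)
  (λ (components-cat , types) → aleph0-from-components em Γ components-cat types)
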